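{- In the Littlestone construction described in the context, for every non-repetitive set $S_{\mathrm{nr}}\subseteq\mathcal{X}$, $$\mathrm{LS}(\mathcal{C}[S_{\mathrm{nr}}],\mathcal{X})\le rk-|S_{\mathrm{nr}}|+r.$$
   Context: Label Cover: $\mathcal{L}=(A,B,E,\Sigma,\{\pi_e\}_{e\in E})$, bipartite graph $(A,B,E)$, finite alphabet $\Sigma$, maps $\pi_{(a,b)}:\Sigma\to\Sigma$, bi-regular. A partial assignment defined on both endpoints of $(a,b)$ violates it if $\pi_{(a,b)}(\sigma(a))\ne\sigma(b)$. $\Sigma^V$ = functions $V\to\Sigma$. Littlestone construction: $n=|A|+|B|$, $r=\sqrt{n}/\log n$ (even), $U_1,\dots,U_r$ a partition of $A\cup B$ with $n/(2r)\le|U_i|\le2n/r$ and $|E|/(2r^2)\le|(U_i\times U_j)\cap E|,|(U_j\times U_i)\cap E|\le2|E|/r^2$; for $i\ne j$, $\mathcal{N}_i(j)\subseteq U_i$ are the vertices of $U_i$ with a neighbor in $U_j$, $\mathcal{N}_i(J)=\bigcup_{j\in J}\mathcal{N}_i(j)$. $k=10^{10}|E|\log|\Sigma|/r^2$. $\mathcal{U}=\mathcal{X}\cup\mathcal{Y}$, $\mathcal{X}=\{x_{i,\sigma_i,j}:i\in[r],\sigma_i\in\Sigma^{U_i},j\in[k]\}$, $\mathcal{Y}=\{y_{I,i,j}:I\subseteq[r]\times[k],i\in[r],j\in[k]\}$. $\ell=1000$. For each $\tilde H\subseteq[r]$, pick $\ell$ random permutations of $[r]$, each giving the perfect matching pairing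 positions $2m-1,2m$; $M_{\tilde H}(i)$ is the set of indices matched with $i$, $T_{\tilde H}=\bigcup_i\mathcal{N}_i(M_{\tilde H}(i))$. $\tau(H)=\{i\in[r]:|\{j:(i,j)\in H\}|\ge k/2\}$. For every $I,H\subseteq[r]\times[k]$ and $\sigma\in\Sigma^{T_{\tau(H)}}$ violating no edge inside $T_{\tau(H)}$, concept $C_{I,H,\sigma}$ contains $x_{i,\sigma_i,j}$ iff $(i,j)\in I$ and $\sigma_i,\sigma$ agree on $\mathcal{N}_i(M_{\tau(H)}(i))$, and contains $y_{I',i,j}$ iff $(i,j)\in H$ and $I'=I$; $\mathcal{C}$ is the set of these concepts. $\mathcal{C}[S]=\{C\in\mathcal{C}:S\subseteq C\}$. $\mathcal{X}_{i,j}=\{x_{i,\sigma_i,j}:\sigma_i\in\Sigma^{U_i}\}$; $S\subseteq\mathcal{X}$ is non-repetitive if $|S\cap\mathcal{X}_{i,j}|\le1$ for all $(i,j)$. $\mathrm{LS}(\mathcal{C}',\mathcal{U}')$ is the maximum $d$ such that a full binary tree of depth $d$ with internal nodes $s\in\{0,1\}^{<d}$ labeled by $v_s\in\mathcal{U}'$ exists in which each leaf $\ell'$ has $C\in\mathcal{C}'$ with $v_{\ell'_{\le i}}\in C\iff\ell'_{i+1}=1$ for all $i<d$. -}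

module Defs where

open import Data.Nat using (ℕ; _+_; _*_; _≤_; _≤ᵇ_)
open import Data.Nat.DivMod using (_/_)
open import Data.Bool using (Bool; true; false; if_then_else_)
open import Data.Fin using (Fin; toℕ)
open import Data.Fin.Subset using (Subset)
open import Data.Fin.Permutation using (Permutation′; _⟨$⟩ˡ_)
open import Data.List using (List; map; allFin; take)
open import Data.Nat.ListAction using (sum)
open import Relation.Nullary.Decidable using (⌊_⌋)
open import Data.List.Relation.Unary.All using (All)
open import Data.List.Relation.Unary.AllPairs using (AllPairs)
open import Data.Vec using (Vec; tabulate; lookup; toList)
open import Data.Sum using (_⊎_; inj₁; inj₂)
open import Data.Product using (Σ; ∃; ∃-syntax; _×_)
open import Data.Empty using (⊥)
open import Relation.Nullary using (¬_)
open import Relation.Binary.PropositionalEquality using (_≡_; _≢_)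
open import Function.Bundles using (_⇔_)

countFin : ∀ {m} → (Fin m → Bool) → ℕ
countFin {m} f = sum (map (λ i → if f i then 1 else 0) (allFin m))

eqFin : ∀ {m} → Fin m → Fin m → Bool
eqFin x y = ⌊ x Data.Fin.≟ y ⌋
  where import Data.Fin

-- A = Fin nA, B = Fin nB, Σ = Fin s, E ⊆ A × B given by a Boolean
-- relation, π a b the projection on edge (a,b), part v = the index i
-- with v ∈ U_i, perms H̃ t = the t-th (t < ℓ = 1000) random permutation
-- chosen for H̃ ⊆ [r] (read as a map  position ↦ element).
record Setup : Set where
  field
    nA nB s : ℕ
    E     : Fin nA → Fin nB → Bool
    π     : Fin nA → Fin nB → Fin s → Fin s
    r k   : ℕ
    part  : Fin nA ⊎ Fin nB → Fin r
    perms : Subset r → Fin 1000 → Permutation′ r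

module Construction (P : Setup) where
  open Setup P

  Vertex : Set
  Vertex = Fin nA ⊎ Fin nB

  n : ℕ
  n = nA + nB

  numE : ℕ
  numE = sum (map (λ a → countFin (E a)) (allFin nA))

  degA : Fin nA → ℕ
  degA a = countFin (E a)

  degB : Fin nB → ℕ
  degB b = countFin (λ a → E a b)

  sizeU : Fin r → ℕ
  sizeU i = countFin (λ a → isI (part (inj₁ a))) + countFin (λ b → isI (part (inj₂ b)))
    where
      isI : Fin r → Bool
      isI j = eqFin j i

  edgesBetween : Fin r → Fin r → ℕ
  edgesBetween i j =
    sum (map (λ a → countFin (λ b →
      if eqFin (part (inj₁ a)) i
      then (if eqFin (part (inj₂ b)) j then E a b else false)
      else false)) (allFin nA))

  adj : Vertex → Vertex → Set
  adj (inj₁ a) (inj₂ b) = E a b ≡ true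
  adj (inj₂ b) (inj₁ a) = E a b ≡ true
  adj (inj₁ _) (inj₁ _) = ⊥
  adj (inj₂ _) (inj₂ _) = ⊥

  N : Fin r → (Fin r → Set) → Vertex → Set
  N i J v = part v ≡ i × ∃[ w ] (adj v w × J (part w) × part w ≢ i)

  -- i and i' are matched by the permutation p (positions 2m-1, 2m,
  -- i.e. 0-based positions 2m, 2m+1)
  Matched : Permutation′ r → Fin r → Fin r → Set
  Matched p i i' = i ≢ i' × toℕ (p ⟨$⟩ˡ i) / 2 ≡ toℕ (p ⟨$⟩ˡ i') / 2

  M : Subset r → Fin r → Fin r → Set
  M H̃ i i' = ∃[ t ] Matched (perms H̃ t) i i'

  -- v ∈ T_H̃ = ⋃_i N_i(M_H̃(i))
  T : Subset r → Vertex → Set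
  T H̃ v = N (part v) (M H̃ (part v)) v

  τ : (Fin r → Fin k → Bool) → Subset r
  τ H = tabulate (λ i → k ≤ᵇ 2 * countFin (H i))

  -- concept parameters (I, H, σ); σ ∈ Σ^{T_τ(H)} is represented by a
  -- total function whose values outside T_τ(H) are irrelevant.
  record Concept : Set where
    field
      I H : Fin r → Fin k → Bool
      σ   : Vertex → Fin s
      consistent : ∀ a b → E a b ≡ true → T (τ H) (inj₁ a) → T (τ H) (inj₂ b) →
                   π a b (σ (inj₁ a)) ≡ σ (inj₂ b)

  -- the element x_{i,σ_i,j} of 𝒳; σ_i ∈ Σ^{U_i} is represented by a total
  -- function whose values outside U_i are irrelevant.
  record XElem : Set where
    constructor x[_,_,_]
    field
      i  : Fin r
      σi : Vertex → Fin s
      j  : Fin k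

  MemX : Concept → XElem → Set
  MemX c x = I (XElem.i x) (XElem.j x) ≡ true ×
             (∀ v → N (XElem.i x) (M (τ H) (XElem.i x)) v → XElem.σi x v ≡ σ v)
    where open Concept c

  -- a finite non-repetitive set S ⊆ 𝒳, given as a list of its elements:
  -- no two entries lie in the same 𝒳_{i,j} (hence all entries are distinct
  -- elements, and |S| = length of the list)
  NonRepetitive : List XElem → Set
  NonRepetitive = AllPairs (λ x y → ¬ (XElem.i x ≡ XElem.i y × XElem.j x ≡ XElem.j y))

  ConceptsContaining : List XElem → Concept → Set
  ConceptsContaining S c = All (MemX c) S

  -- a Littlestone tree of depth d with labels in 𝒳 shattered by the class
  -- 𝒞' (given as a predicate on concepts): internal node s ∈ {0,1}^{<d} has
  -- label lab s; every leaf ℓ' ∈ {0,1}^d has a concept C ∈ 𝒞' with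
  -- v_{ℓ'≤q} ∈ C ⇔ ℓ'_{q+1} = 1 for all q < d.
  LittlestoneTree : (Concept → Set) → ℕ → Set
  LittlestoneTree 𝒞' d =
    Σ (List Bool → XElem) λ lab →
      (leaf : Vec Bool d) →
        ∃[ c ] (𝒞' c × ((q : Fin d) →
          MemX c (lab (take (toℕ q) (toList leaf))) ⇔ (lookup leaf q ≡ true)))

  record Hypotheses : Set where
    field
      biregA  : ∀ a a' → degA a ≡ degA a'
      biregB  : ∀ b b' → degB b ≡ degB b'
      r-even  : ∃[ m ] r ≡ 2 * m
      U-lo    : ∀ i → n ≤ 2 * r * sizeU i
      U-hi    : ∀ i → r * sizeU i ≤ 2 * n
      E-lo    : ∀ i j → numE ≤ 2 * (r * r) * edgesBetween i j
      E-hi    : ∀ i j → (r * r) * edgesBetween i j ≤ 2 * numE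

-- Index the elements of 𝒳 by their cells (i, j), of which there are rk. Walk down
-- a shattered tree, keeping the list of labels already known to lie in every
-- concept of the current subtree. A node whose label shares its cell with a known
-- positive y separates its two subtrees by the value of τ(H): membership of
-- x_{i,σ_i,j} in C_{I,H,σ} is decided by I(i,j) and by σ on N_i(M_τ(H)(i)), and the
-- known positive y pins down both. A node whose label lies in a new cell is
-- followed into its 1-subtree, where the label becomes a known positive. Only
-- rk - |S| new cells exist, so a tree of depth d yields 2^(d - (rk - |S|)) leaves
-- with pairwise distinct τ(H) ∈ 2^[r], whence d - (rk - |S|) ≤ r.
module Submission where

open import Defs
open import Data.Bool using (Bool; true; false)
open import Data.Empty using (⊥-elim)
open import Data.Fin using (Fin; zero; suc; toℕ; combine; _≟_)
open import Data.Fin.Properties using (2↔Bool; *↔×; injective⇒≤; combine-injective)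
open import Data.List using (List; []; _∷_; length; lookup; take)
open import Data.List.Membership.Propositional.Properties using (∈-lookup)
open import Data.List.Relation.Unary.All as All using (All; _∷_)
open import Data.List.Relation.Unary.All.Properties using (¬Any⇒All¬)
open import Data.List.Relation.Unary.AllPairs as AllPairs using (AllPairs; _∷_)
open import Data.List.Relation.Unary.Any using (Any; here; there; any?)
open import Data.Nat using (ℕ; zero; suc; _+_; _*_; _∸_; _≤_; _<_; _^_; z≤n; s≤s; s≤s⁻¹)
open import Data.Nat.Properties
  using (≤-refl; ≤-trans; ≮⇒≥; <⇒≱; n≮0; +-suc; +-monoʳ-≤; ^-monoʳ-<; 0∸n≡0; +-∸-assoc;
         m≤n+m∸n; m≤n+o⇒m∸n≤o; module ≤-Reasoning)
open import Data.Product using (Σ; ∃-syntax; _×_; _,_; proj₁; proj₂)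
open import Data.Product.Function.NonDependent.Propositional using (_×-↔_)
open import Data.Vec as Vec using (Vec; []; _∷_; toList; replicate; uncons)
open import Function using (id; _∘_; _on_; Injective)
open import Function.Bundles using (_↔_; _↣_; _⇔_; Equivalence; Injection; mk↔ₛ′)
open import Function.Properties.Inverse using (↔-sym; ↔-trans; ↔⇒↣)
open import Relation.Binary.PropositionalEquality
open import Relation.Nullary using (¬_; yes; no)

bits↔Fin : ∀ n → Vec Bool n ↔ Fin (2 ^ n)
bits↔Fin zero = mk↔ₛ′ (λ _ → zero) (λ _ → []) (λ { zero → refl }) (λ { [] → refl })
bits↔Fin (suc n) =
  ↔-trans (mk↔ₛ′ uncons (λ (b , bs) → b ∷ bs) (λ _ → refl) (λ { (_ ∷ _) → refl }))
  (↔-trans (↔-sym 2↔Bool ×-↔ bits↔Fin n) (↔-sym *↔×))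

bits-injective⇒≤ : ∀ {m n} {f : Vec Bool m → Vec Bool n} → Injective _≡_ _≡_ f → m ≤ n
bits-injective⇒≤ {m} {n} {f} f-inj = ≮⇒≥ λ n<m → <⇒≱ (^-monoʳ-< 2 (s≤s (s≤s z≤n)) n<m) 2^m≤2^n
  where
  open Injection
  encode : ∀ k → Vec Bool k ↣ Fin (2 ^ k)
  encode k = ↔⇒↣ (bits↔Fin k)
  decode : ∀ k → Fin (2 ^ k) ↣ Vec Bool k
  decode k = ↔⇒↣ (↔-sym (bits↔Fin k))
  2^m≤2^n : 2 ^ m ≤ 2 ^ n
  2^m≤2^n = injective⇒≤ (injective (decode m) ∘ f-inj ∘ injective (encode n))

[1+m]∸n≤1+[m∸n] : ∀ m n → suc m ∸ n ≤ suc (m ∸ n)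
[1+m]∸n≤1+[m∸n] m n = m≤n+o⇒m∸n≤o (suc m) n (begin
  suc m            ≤⟨ s≤s (m≤n+m∸n m n) ⟩
  suc (n + (m ∸ n)) ≡⟨ +-suc n (m ∸ n) ⟨
  n + suc (m ∸ n)   ∎)
  where open ≤-Reasoning

m∸n≡1+[m∸[1+n]] : ∀ {m n} → n < m → m ∸ n ≡ suc (m ∸ suc n)
m∸n≡1+[m∸[1+n]] = +-∸-assoc 1

module _ {A : Set} {n : ℕ} (f : A → Fin n) where

  lookup-injective : ∀ {xs} → AllPairs (_≢_ on f) xs →
                     Injective _≡_ _≡_ (f ∘ lookup xs)
  lookup-injective {_ ∷ _} (_ ∷ _) {zero} {zero} _ = refl
  lookup-injective {_ ∷ _} (x≢xs ∷ _) {zero} {suc j} eq = ⊥-elim (All.lookup x≢xs (∈-lookup j) eq)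
  lookup-injective {_ ∷ _} (x≢xs ∷ _) {suc i} {zero} eq = ⊥-elim (All.lookup x≢xs (∈-lookup i) (sym eq))
  lookup-injective {_ ∷ _} (_ ∷ distinct) {suc i} {suc j} eq = cong suc (lookup-injective distinct eq)

  distinct-images⇒length≤ : ∀ {xs} → AllPairs (_≢_ on f) xs → length xs ≤ n
  distinct-images⇒length≤ distinct = injective⇒≤ (lookup-injective distinct)

module CellShattering {X C Sig : Set} (Mem : C → X → Set) {K : ℕ} (cell : X → Fin K)
    (sig : C → Sig)
    (determined : ∀ {c c′ x y} → cell x ≡ cell y → sig c ≡ sig c′ →
                  Mem c y → Mem c′ y → Mem c x → Mem c′ x) where

  private variable
    Pos : List X
    lab : List Bool → X
    d m : ℕ

  Distinct : List X → Set
  Distinct = AllPairs (_≢_ on cell)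

  freeCells : List X → ℕ
  freeCells Pos = K ∸ length Pos

  record Shatters (Pos : List X) (lab : List Bool → X) (d : ℕ) : Set where
    constructor shatters
    field
      leaf : (v : Vec Bool d) → ∃[ c ] (All (Mem c) Pos ×
        ((q : Fin d) → Mem c (lab (take (toℕ q) (toList v))) ⇔ (Vec.lookup v q ≡ true)))

  open Shatters

  concept : Shatters Pos lab d → Vec Bool d → C
  concept sh v = proj₁ (leaf sh v)

  subtree : Shatters Pos lab (suc d) → (b : Bool) → Shatters Pos (lab ∘ (b ∷_)) d
  subtree sh b = shatters λ v → let c , pos , path = leaf sh (b ∷ v) in c , pos , path ∘ suc

  subtree-learning-root : Shatters Pos lab (suc d) →
                          Shatters (lab [] ∷ Pos) (lab ∘ (true ∷_)) d
  subtree-learning-root sh = shatters λ v →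
    let c , pos , path = leaf sh (true ∷ v) in
    c , Equivalence.from (path zero) refl ∷ pos , path ∘ suc

  root-separates : (sh : Shatters Pos lab (suc d)) → Any (λ y → cell (lab []) ≡ cell y) Pos →
                   ∀ v w → sig (concept sh (false ∷ v)) ≢ sig (concept sh (true ∷ w))
  root-separates {Pos = Pos} {lab = lab} sh known v w same = root∉₀ (root∈₀ known pos₀ pos₁)
    where
    c₀ c₁ : C
    c₀ = concept sh (false ∷ v)
    c₁ = concept sh (true ∷ w)
    pos₀ : All (Mem c₀) Pos
    pos₀ = proj₁ (proj₂ (leaf sh (false ∷ v)))
    pos₁ : All (Mem c₁) Pos
    pos₁ = proj₁ (proj₂ (leaf sh (true ∷ w)))
    root∉₀ : ¬ Mem c₀ (lab [])
    root∉₀ root∈ with () ← Equivalence.to (proj₂ (proj₂ (leaf sh (false ∷ v))) zero) root∈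
    root∈₁ : Mem c₁ (lab [])
    root∈₁ = Equivalence.from (proj₂ (proj₂ (leaf sh (true ∷ w))) zero) refl
    root∈₀ : ∀ {ys} → Any (λ y → cell (lab []) ≡ cell y) ys →
             All (Mem c₀) ys → All (Mem c₁) ys → Mem c₀ (lab [])
    root∈₀ (here eq) (y∈₀ ∷ _) (y∈₁ ∷ _) = determined eq (sym same) y∈₁ y∈₀ root∈₁
    root∈₀ (there p) (_ ∷ ys⊆₀) (_ ∷ ys⊆₁) = root∈₀ p ys⊆₀ ys⊆₁

  SeparatedLeaves : Shatters Pos lab d → ℕ → Set
  SeparatedLeaves {d = d} sh m =
    Σ (Vec Bool m → Vec Bool d) λ ψ → Injective _≡_ _≡_ (sig ∘ concept sh ∘ ψ)

  separated-through-known-root : (sh : Shatters Pos lab (suc d)) →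
    Any (λ y → cell (lab []) ≡ cell y) Pos →
    SeparatedLeaves (subtree sh false) m → SeparatedLeaves (subtree sh true) m →
    SeparatedLeaves sh (suc m)
  separated-through-known-root {d = d} {m = m} sh known (ψ₀ , inj₀) (ψ₁ , inj₁) = ψ , inj
    where
    ψ : Vec Bool (suc m) → Vec Bool (suc d)
    ψ (false ∷ w) = false ∷ ψ₀ w
    ψ (true ∷ w) = true ∷ ψ₁ w
    inj : Injective _≡_ _≡_ (sig ∘ concept sh ∘ ψ)
    inj {false ∷ v} {false ∷ w} eq = cong (false ∷_) (inj₀ eq)
    inj {true ∷ v} {true ∷ w} eq = cong (true ∷_) (inj₁ eq)
    inj {false ∷ v} {true ∷ w} eq = ⊥-elim (root-separates sh known (ψ₀ v) (ψ₁ w) eq)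
    inj {true ∷ v} {false ∷ w} eq = ⊥-elim (root-separates sh known (ψ₀ w) (ψ₁ v) (sym eq))

  separated-through-new-root : (sh : Shatters Pos lab (suc d)) →
    SeparatedLeaves (subtree-learning-root sh) m → SeparatedLeaves sh m
  separated-through-new-root sh (ψ , inj) = (true ∷_) ∘ ψ , inj

  separated-leaves : Distinct Pos → (sh : Shatters Pos lab d) →
                     m ≤ d ∸ freeCells Pos → SeparatedLeaves sh m
  separated-leaves {d = d} {m = zero} _ _ _ = (λ _ → replicate d false) , λ { {[]} {[]} _ → refl }
  separated-leaves {Pos = Pos} {d = zero} {m = suc m} _ _ budget =
    ⊥-elim (n≮0 (subst (m <_) (0∸n≡0 (freeCells Pos)) budget))
  separated-leaves {Pos = Pos} {lab = lab} {d = suc d} {m = suc m} distinct sh budget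
    with any? (λ y → cell (lab []) ≟ cell y) Pos
  ... | yes known = separated-through-known-root sh known
    (separated-leaves distinct (subtree sh false) budget′)
    (separated-leaves distinct (subtree sh true) budget′)
    where
    budget′ : m ≤ d ∸ freeCells Pos
    budget′ = s≤s⁻¹ (≤-trans budget ([1+m]∸n≤1+[m∸n] d (freeCells Pos)))
  ... | no new = separated-through-new-root sh
    (separated-leaves distinct′ (subtree-learning-root sh) budget′)
    where
    distinct′ : Distinct (lab [] ∷ Pos)
    distinct′ = ¬Any⇒All¬ Pos new ∷ distinct
    budget′ : suc m ≤ d ∸ freeCells (lab [] ∷ Pos)
    budget′ = subst (λ f → suc m ≤ suc d ∸ f)
      (m∸n≡1+[m∸[1+n]] (distinct-images⇒length≤ cell distinct′)) budget

  depth≤freeCells+bits : ∀ {n} {enc : Sig → Vec Bool n} → Injective _≡_ _≡_ enc →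
                         Distinct Pos → Shatters Pos lab d → d ≤ freeCells Pos + n
  depth≤freeCells+bits {Pos = Pos} {d = d} {n = n} enc-inj distinct sh = begin
    d                                   ≤⟨ m≤n+m∸n d (freeCells Pos) ⟩
    freeCells Pos + (d ∸ freeCells Pos) ≤⟨ +-monoʳ-≤ (freeCells Pos) leaves≤bits ⟩
    freeCells Pos + n                   ∎
    where
    open ≤-Reasoning
    leaves≤bits : d ∸ freeCells Pos ≤ n
    leaves≤bits = bits-injective⇒≤ (proj₂ (separated-leaves distinct sh ≤-refl) ∘ enc-inj)

module Littlestone (P : Setup) where
  open Setup P
  open Construction P
  open XElem

  cell : XElem → Fin (r * k)
  cell x = combine (i x) (j x)

  memX-determined : ∀ {c c′ x y} → cell x ≡ cell y → τ (Concept.H c) ≡ τ (Concept.H c′) →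
                    MemX c y → MemX c′ y → MemX c x → MemX c′ x
  memX-determined {c} {c′} {x[ i , σx , j ]} {x[ i′ , σy , j′ ]} same-cell same-τ y∈c y∈c′ x∈c
    with refl , refl ← combine-injective i j i′ j′ same-cell =
    proj₁ y∈c′ , λ v v∈N →
      let v∈N′ = subst (λ T → N i (M T i) v) (sym same-τ) v∈N in
      begin
        σx v           ≡⟨ proj₂ x∈c v v∈N′ ⟩
        Concept.σ c v  ≡⟨ proj₂ y∈c v v∈N′ ⟨
        σy v           ≡⟨ proj₂ y∈c′ v v∈N ⟩
        Concept.σ c′ v ∎
    where open ≡-Reasoning

  nonRepetitive⇒distinct : ∀ {S} → NonRepetitive S → AllPairs (_≢_ on cell) S
  nonRepetitive⇒distinct = AllPairs.map λ {x} {y} different same →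
    different (combine-injective (i x) (j x) (i y) (j y) same)

  open CellShattering MemX cell (τ ∘ Concept.H)
    (λ {c} {c′} {x} {y} → memX-determined {c} {c′} {x} {y}) public

corollary28 : (P : Setup) → Construction.Hypotheses P →
    (S : List (Construction.XElem P)) → Construction.NonRepetitive P S →
    (d : ℕ) → Construction.LittlestoneTree P (Construction.ConceptsContaining P S) d →
    d ≤ Setup.r P * Setup.k P ∸ length S + Setup.r P
corollary28 P _ S nonRep d (lab , tree) =
  depth≤freeCells+bits id (nonRepetitive⇒distinct nonRep) (shatters {lab = lab} tree)
  where open Littlestone P
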